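{- Fix $n$ and $t$ with $n\ge 4$ and $3\le t\le n-1$. If $G$ is an $n$-vertex graph with minimum degree at least $1$ and $G\ne K_{1,n-1}$, then $i_t(G)<i_t(K_{1,n-1})$.
   Context: All graphs are simple, loopless and finite. $i_t(G)$ is the number of independent sets (vertex subsets spanning no edge) of size $t$ in $G$. $K_{1,n-1}$ is the star on $n$ vertices. -}

module Defs where

open import Data.Nat using (ℕ; zero; suc; _+_)
open import Data.Bool using (Bool; true; false; _∧_; not; if_then_else_)
open import Data.Fin using (Fin; zero; suc)
open import Data.Fin.Subset using (Subset; inside; outside; ∣_∣)
open import Data.Vec using (Vec; []; _∷_; lookup)
open import Data.List using (List; []; _∷_; map; _++_; filter; length; allFin; foldr)
open import Data.Product using (Σ; _×_)
open import Relation.Binary.PropositionalEquality using (_≡_)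
open import Relation.Nullary using (¬_)
open import Data.Nat using (_≟_)
open import Function.Bundles using (_↔_; Inverse)

record Graph (n : ℕ) : Set where
  field
    adj   : Fin n → Fin n → Bool
    sym   : ∀ u v → adj u v ≡ adj v u
    loopless : ∀ v → adj v v ≡ false
open Graph public

degree : ∀ {n} → Graph n → Fin n → ℕ
degree G v = length (filter (λ u → adj G v u Data.Bool.≟ true) (allFin _))

MinDegreeAtLeast1 : ∀ {n} → Graph n → Set
MinDegreeAtLeast1 {n} G = ∀ (v : Fin n) → 1 Data.Nat.≤ degree G v

allSubsets : (n : ℕ) → List (Subset n)
allSubsets zero = [] ∷ []
allSubsets (suc n) = map (outside ∷_) (allSubsets n) ++ map (inside ∷_) (allSubsets n)

member : ∀ {n} → Subset n → Fin n → Bool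
member S v with lookup S v
... | inside = true
... | outside = false

allB : ∀ {A : Set} → (A → Bool) → List A → Bool
allB p = foldr (λ x b → p x ∧ b) true

isIndependent : ∀ {n} → Graph n → Subset n → Bool
isIndependent {n} G S =
  allB (λ u → allB (λ v → not (member S u ∧ member S v ∧ adj G u v)) (allFin n)) (allFin n)

indepCount : ∀ {n} → Graph n → ℕ → ℕ
indepCount {n} G t =
  length (filter (λ S → (isIndependent G S Data.Bool.≟ true)) (filter (λ S → ∣ S ∣ ≟ t) (allSubsets n)))

starAdj : ∀ {m} → Fin (suc m) → Fin (suc m) → Bool
starAdj zero zero = false
starAdj zero (suc _) = true
starAdj (suc _) zero = true
starAdj (suc _) (suc _) = false

star : (m : ℕ) → Graph (suc m)
star m = record { adj = starAdj ; sym = s ; loopless = l }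
  where
  s : ∀ u v → starAdj {m} u v ≡ starAdj v u
  s zero zero = Relation.Binary.PropositionalEquality.refl
  s zero (suc _) = Relation.Binary.PropositionalEquality.refl
  s (suc _) zero = Relation.Binary.PropositionalEquality.refl
  s (suc _) (suc _) = Relation.Binary.PropositionalEquality.refl
  l : ∀ v → starAdj {m} v v ≡ false
  l zero = Relation.Binary.PropositionalEquality.refl
  l (suc _) = Relation.Binary.PropositionalEquality.refl

_≅_ : ∀ {n} → Graph n → Graph n → Set
_≅_ {n} G H = Σ (Fin n ↔ Fin n) λ f →
  ∀ u v → adj G u v ≡ adj H (Inverse.to f u) (Inverse.to f v)

-- Fix a neighbour p u of every vertex u.  Map an independent t-set I of G to
-- a t-set of leaves {1, …, n-1} of the star: I itself if 0 ∉ I; otherwise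
-- J = I - 0 together with p v for a vertex v of J picked by a selection rule.
-- Images of the second kind contain the edge v (p v), so they avoid those of
-- the first kind, and two of them can only coincide if J₁ = C + a and
-- J₂ = C + b for twins a = p b, b = p a; the rule never picks the twin in
-- both.  This injection gives i_t(G) ≤ i_t(K_{1,n-1}).  If G is not a star,
-- some edge a b avoids 0 while a neighbour z of 0 lies outside {a, b}; no
-- leaf t-set containing a, b and z is an image, so the inequality is strict.
module Submission where

open import Defs renaming (sym to adj-sym)
open import Data.Nat using (ℕ; zero; suc; _+_; _*_; _∸_; _⊓_; _≤_; _<_; z≤n; s≤s)
import Data.Nat.Properties as ℕ
open import Data.Nat.Properties
  using ( ≤-trans; ≤-refl; ≤-reflexive; ≤-pred; <⇒≤; ≤-<-trans; ≮⇒≥; <⇒≱; ≤∧≢⇒<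
        ; n≤1+n; m≤m+n; +-suc; +-identityʳ; +-comm; +-cancelˡ-≡; +-monoʳ-<; *-monoˡ-≤
        ; m+[n∸m]≡n; ⊓-sel)
open import Data.Bool using (Bool; true; false; _∧_; not; _xor_)
import Data.Bool.Properties as Bool
open import Data.Empty using (⊥-elim)
open import Data.Fin using (Fin; zero; suc; toℕ; _≟_; _<?_)
open import Data.Fin.Properties
  using (toℕ-injective; toℕ<n; suc-injective; <-cmp; <-asym; any?)
open import Data.Fin.Permutation using (transpose; _⟨$⟩ʳ_; _⟨$⟩ˡ_; inverseˡ; inverseʳ)
open import Data.Fin.Subset using (Subset; Side; inside; outside; _∈_; _∉_; _⊆_; ∣_∣; ⊤; ⁅_⁆)
open import Data.Fin.Subset.Properties
  using (_∈?_; ∈⊤; p⊆q⇒∣p∣≤∣q∣; ∣⊤∣≡n; x∈⁅x⁆; x∈⁅y⁆⇒x≡y; ∣⁅x⁆∣≡1)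
open import Data.Vec using ([]; _∷_; lookup; _[_]≔_; here; there)
open import Data.Vec.Properties using ([]=⇒lookup; lookup⇒[]=; ∷-injectiveʳ; []≔-commutes)
open import Data.List using (List; []; _∷_; map; filter; allFin; length)
open import Data.List.Properties using (length-removeAt′)
import Data.List.Membership.Propositional as L
open import Data.List.Membership.Propositional.Properties
  using (∈-map⁺; ∈-map⁻; ∈-++⁺ˡ; ∈-++⁺ʳ; ∈-filter⁺; ∈-filter⁻; ∈-allFin)
open import Data.List.Relation.Unary.Any using (here; there; _─_)
import Data.List.Relation.Unary.All as All
import Data.List.Relation.Unary.AllPairs as AllPairs
open import Data.List.Relation.Unary.Unique.Propositional using (Unique)
import Data.List.Relation.Unary.Unique.Propositional.Properties as Unique
open import Data.List.Extrema.Nat using (argmin; argmin-sel; f[argmin]≤f[⊤]; f[argmin]≤f[xs])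
open import Data.Product using (∃; ∃₂; _×_; _,_; proj₁; proj₂)
open import Data.Sum using (_⊎_; inj₁; inj₂; [_,_])
import Data.Sum as Sum
open import Function using (_∘_; case_of_; mk⇔)
open import Relation.Binary.Definitions using (tri<; tri≈; tri>)
open import Relation.Binary.PropositionalEquality
  using (_≡_; _≢_; refl; sym; trans; cong; cong₂; subst; subst₂; module ≡-Reasoning)
open import Relation.Nullary using (¬_; Dec; yes; no; does; contradiction)
open import Relation.Nullary.Decidable using (dec-true; dec-false; does-⇔; decidable-stable; ¬?; _×-dec_)

private variable
  n : ℕ
  x y : Fin n
  s : Side
  S T : Subset n

-- Comparing lengths of lists by an injection

∈-─⁺ : ∀ {A : Set} {x y : A} {xs} (x∈xs : x L.∈ xs) → y L.∈ xs → y ≢ x →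
       y L.∈ (xs ─ x∈xs)
∈-─⁺ (here refl)  (here refl)  y≢x = contradiction refl y≢x
∈-─⁺ (here refl)  (there y∈xs) _   = y∈xs
∈-─⁺ (there _)    (here refl)  _   = here refl
∈-─⁺ (there x∈xs) (there y∈xs) y≢x = there (∈-─⁺ x∈xs y∈xs y≢x)

length<-by-injectionOn : ∀ {A B : Set} (f : A → B) {xs ys} → Unique xs →
  (∀ {x} → x L.∈ xs → f x L.∈ ys) →
  (∀ {x y} → x L.∈ xs → y L.∈ xs → f x ≡ f y → x ≡ y) →
  ∀ {k} → k L.∈ ys → (∀ {x} → x L.∈ xs → f x ≢ k) →
  length xs < length ys
length<-by-injectionOn f {[]} _ _ _ (here _)  _ = s≤s z≤n
length<-by-injectionOn f {[]} _ _ _ (there _) _ = s≤s z≤n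
length<-by-injectionOn f {x ∷ xs} {ys} (x∉xs AllPairs.∷ xs!) maps inj {k} k∈ys k∉f[xs] =
  subst (suc (length xs) <_) (sym (length-removeAt′ ys _))
    (s≤s (length<-by-injectionOn f xs! maps′ inj′ k∈ys′ (k∉f[xs] ∘ there)))
  where
  fx∈ys : f x L.∈ ys
  fx∈ys = maps (here refl)
  maps′ : ∀ {y} → y L.∈ xs → f y L.∈ (ys ─ fx∈ys)
  maps′ y∈xs = ∈-─⁺ fx∈ys (maps (there y∈xs)) λ fy≡fx →
    All.lookup x∉xs y∈xs (sym (inj (there y∈xs) (here refl) fy≡fx))
  inj′ : ∀ {y z} → y L.∈ xs → z L.∈ xs → f y ≡ f z → y ≡ z
  inj′ y∈xs z∈xs = inj (there y∈xs) (there z∈xs)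
  k∈ys′ : k L.∈ (ys ─ fx∈ys)
  k∈ys′ = ∈-─⁺ fx∈ys k∈ys λ k≡fx → k∉f[xs] (here refl) (sym k≡fx)

-- Inserting and deleting single elements of subsets

∈-insert : x ∈ S [ x ]≔ inside
∈-insert {x = zero}  {_ ∷ _} = here
∈-insert {x = suc x} {_ ∷ _} = there ∈-insert

∈-update⁺ : y ∈ S → y ≢ x → ∀ s → y ∈ S [ x ]≔ s
∈-update⁺ {x = zero}  here        y≢x _ = contradiction refl y≢x
∈-update⁺ {x = suc x} here        _   _ = here
∈-update⁺ {x = zero}  (there y∈S) _   _ = there y∈S
∈-update⁺ {x = suc x} (there y∈S) y≢x s = there (∈-update⁺ y∈S (y≢x ∘ cong suc) s)

∈-update⁻ : y ∈ S [ x ]≔ s → y ≢ x → y ∈ S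
∈-update⁻ {S = _ ∷ _} {x = zero}  here        y≢x = contradiction refl y≢x
∈-update⁻ {S = _ ∷ _} {x = suc x} here        _   = here
∈-update⁻ {S = _ ∷ _} {x = zero}  (there y∈S) _   = there y∈S
∈-update⁻ {S = _ ∷ _} {x = suc x} (there y∈S) y≢x = there (∈-update⁻ y∈S (y≢x ∘ cong suc))

∈-insert⁺ : y ∈ S → y ∈ S [ x ]≔ inside
∈-insert⁺ {y = y} {x = x} y∈S with y ≟ x
... | yes refl = ∈-insert
... | no y≢x   = ∈-update⁺ y∈S y≢x inside

∈-insert⁻ : y ∈ S [ x ]≔ inside → y ≡ x ⊎ y ∈ S
∈-insert⁻ {y = y} {x = x} y∈S′ with y ≟ x
... | yes y≡x = inj₁ y≡x
... | no y≢x  = inj₂ (∈-update⁻ y∈S′ y≢x)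

∉-delete : x ∉ S [ x ]≔ outside
∉-delete {x = zero}  {_ ∷ _} ()
∉-delete {x = suc x} {_ ∷ _} (there x∈S) = ∉-delete x∈S

insert-∈ : x ∈ S → S [ x ]≔ inside ≡ S
insert-∈ {x = zero}  {inside ∷ S} here        = refl
insert-∈ {x = suc x} {s ∷ S}      (there x∈S) = cong (s ∷_) (insert-∈ x∈S)

delete-insert : x ∉ S → (S [ x ]≔ inside) [ x ]≔ outside ≡ S
delete-insert {x = zero}  {outside ∷ S} _   = refl
delete-insert {x = zero}  {inside ∷ S}  x∉S = contradiction here x∉S
delete-insert {x = suc x} {s ∷ S}       x∉S = cong (s ∷_) (delete-insert (x∉S ∘ there))

insert-delete : x ∈ S → (S [ x ]≔ outside) [ x ]≔ inside ≡ S
insert-delete {x = zero}  {inside ∷ S} here        = refl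
insert-delete {x = suc x} {s ∷ S}      (there x∈S) = cong (s ∷_) (insert-delete x∈S)

∣insert∣≡ : x ∉ S → ∣ S [ x ]≔ inside ∣ ≡ suc ∣ S ∣
∣insert∣≡ {x = zero}  {outside ∷ S} _   = refl
∣insert∣≡ {x = zero}  {inside ∷ S}  x∉S = contradiction here x∉S
∣insert∣≡ {x = suc x} {outside ∷ S} x∉S = ∣insert∣≡ (x∉S ∘ there)
∣insert∣≡ {x = suc x} {inside ∷ S}  x∉S = cong suc (∣insert∣≡ (x∉S ∘ there))

∣insert∣≤ : ∀ x (S : Subset n) → ∣ S [ x ]≔ inside ∣ ≤ suc ∣ S ∣
∣insert∣≤ x S with x ∈? S
... | no x∉S  = ≤-reflexive (∣insert∣≡ x∉S)
... | yes x∈S = subst (λ R → ∣ R ∣ ≤ suc ∣ S ∣) (sym (insert-∈ x∈S)) (n≤1+n _)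

nonempty : 1 ≤ ∣ S ∣ → ∃ (_∈ S)
nonempty {S = inside ∷ S}  _     = zero , here
nonempty {S = outside ∷ S} 1≤∣S∣ = let x , x∈S = nonempty 1≤∣S∣ in suc x , there x∈S

two-members : 2 ≤ ∣ S ∣ → ∃₂ λ x y → x ∈ S × y ∈ S × x ≢ y
two-members {S = inside ∷ S} (s≤s 1≤∣S∣) =
  let y , y∈S = nonempty 1≤∣S∣ in zero , suc y , here , there y∈S , λ ()
two-members {S = outside ∷ S} 2≤∣S∣ =
  let x , y , x∈S , y∈S , x≢y = two-members 2≤∣S∣
  in  suc x , suc y , there x∈S , there y∈S , x≢y ∘ suc-injective

∣∣<⇒∃∉ : ∣ S ∣ < ∣ T ∣ → ∃ λ x → x ∈ T × x ∉ S
∣∣<⇒∃∉ {S = S} {T = T} ∣S∣<∣T∣ with any? (λ x → x ∈? T ×-dec ¬? (x ∈? S))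
... | yes found = found
... | no none   = contradiction (p⊆q⇒∣p∣≤∣q∣ T⊆S) (<⇒≱ ∣S∣<∣T∣)
  where
  T⊆S : T ⊆ S
  T⊆S {x} x∈T with x ∈? S
  ... | yes x∈S = x∈S
  ... | no x∉S  = contradiction (x , x∈T , x∉S) none

⊆-extend-by : ∀ d → S ⊆ T → ∣ S ∣ + d ≤ ∣ T ∣ →
              ∃ λ K → S ⊆ K × K ⊆ T × ∣ K ∣ ≡ ∣ S ∣ + d
⊆-extend-by {S = S} zero    S⊆T _ = S , (λ x∈S → x∈S) , S⊆T , sym (+-identityʳ _)
⊆-extend-by {S = S} {T} (suc d) S⊆T ∣S∣+1+d≤∣T∣ = grow (∣∣<⇒∃∉ ∣S∣<∣T∣)
  where
  ∣S∣<∣T∣ : ∣ S ∣ < ∣ T ∣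
  ∣S∣<∣T∣ = ≤-trans (s≤s (m≤m+n ∣ S ∣ d))
                    (subst (_≤ ∣ T ∣) (+-suc ∣ S ∣ d) ∣S∣+1+d≤∣T∣)
  grow : (∃ λ x → x ∈ T × x ∉ S) → ∃ λ K → S ⊆ K × K ⊆ T × ∣ K ∣ ≡ ∣ S ∣ + suc d
  grow (x , x∈T , x∉S) =
    let K , S′⊆K , K⊆T , ∣K∣≡ =
          ⊆-extend-by d S′⊆T (subst (_≤ ∣ T ∣) ∣S∣+1+d≡ ∣S∣+1+d≤∣T∣)
    in  K , S′⊆K ∘ ∈-insert⁺ , K⊆T , trans ∣K∣≡ (sym ∣S∣+1+d≡)
    where
    S′⊆T : S [ x ]≔ inside ⊆ T
    S′⊆T y∈S′ with ∈-insert⁻ y∈S′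
    ... | inj₁ refl = x∈T
    ... | inj₂ y∈S  = S⊆T y∈S
    ∣S∣+1+d≡ : ∣ S ∣ + suc d ≡ ∣ S [ x ]≔ inside ∣ + d
    ∣S∣+1+d≡ = trans (+-suc ∣ S ∣ d) (cong (_+ d) (sym (∣insert∣≡ x∉S)))

⊆-extend : ∀ {t} → S ⊆ T → ∣ S ∣ ≤ t → t ≤ ∣ T ∣ →
           ∃ λ K → S ⊆ K × K ⊆ T × ∣ K ∣ ≡ t
⊆-extend {S = S} {T} {t} S⊆T ∣S∣≤t t≤∣T∣ =
  let ∣S∣+[t∸∣S∣]≡t = m+[n∸m]≡n ∣S∣≤t
      K , S⊆K , K⊆T , ∣K∣≡ =
        ⊆-extend-by (t ∸ ∣ S ∣) S⊆T (subst (_≤ ∣ T ∣) (sym ∣S∣+[t∸∣S∣]≡t) t≤∣T∣)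
  in  K , S⊆K , K⊆T , trans ∣K∣≡ ∣S∣+[t∸∣S∣]≡t

triple : Fin n → Fin n → Fin n → Subset n
triple x y z = (⁅ x ⁆ [ y ]≔ inside) [ z ]≔ inside

∈-triple : ∀ (x y z : Fin n) → x ∈ triple x y z × y ∈ triple x y z × z ∈ triple x y z
∈-triple x y z = ∈-insert⁺ (∈-insert⁺ (x∈⁅x⁆ x)) , ∈-insert⁺ ∈-insert , ∈-insert

∈-triple⁻ : ∀ {u} (x y z : Fin n) → u ∈ triple x y z → u ≡ x ⊎ u ≡ y ⊎ u ≡ z
∈-triple⁻ x y z u∈ with ∈-insert⁻ u∈
... | inj₁ u≡z = inj₂ (inj₂ u≡z)
... | inj₂ u∈′ with ∈-insert⁻ u∈′
...   | inj₁ u≡y = inj₂ (inj₁ u≡y)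
...   | inj₂ u∈x = inj₁ (x∈⁅y⁆⇒x≡y x u∈x)

∣triple∣≤3 : ∀ (x y z : Fin n) → ∣ triple x y z ∣ ≤ 3
∣triple∣≤3 x y z = ≤-trans (∣insert∣≤ z (⁅ x ⁆ [ y ]≔ inside))
  (s≤s (≤-trans (∣insert∣≤ y ⁅ x ⁆) (s≤s (≤-reflexive (∣⁅x⁆∣≡1 x)))))

∃-∉triple : ∀ (x y z : Fin n) → 3 < n → ∃ λ c → c ≢ x × c ≢ y × c ≢ z
∃-∉triple {n} x y z 3<n =
  let c , _ , c∉ = ∣∣<⇒∃∉ {S = triple x y z} {T = ⊤}
                     (subst (∣ triple x y z ∣ <_) (sym (∣⊤∣≡n n))
                       (≤-<-trans (∣triple∣≤3 x y z) 3<n))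
      x∈ , y∈ , z∈ = ∈-triple x y z
      avoids : ∀ {w} → w ∈ triple x y z → c ≢ w
      avoids w∈ c≡w = c∉ (subst (_∈ triple x y z) (sym c≡w) w∈)
  in  c , avoids x∈ , avoids y∈ , avoids z∈

-- Independent sets and their number

∈-allSubsets : (S : Subset n) → S L.∈ allSubsets n
∈-allSubsets []                     = here refl
∈-allSubsets {suc n} (outside ∷ S) = ∈-++⁺ˡ (∈-map⁺ (outside ∷_) (∈-allSubsets S))
∈-allSubsets {suc n} (inside ∷ S)  =
  ∈-++⁺ʳ (map (outside ∷_) (allSubsets n)) (∈-map⁺ (inside ∷_) (∈-allSubsets S))

allSubsets-unique : ∀ n → Unique (allSubsets n)
allSubsets-unique zero    = All.[] AllPairs.∷ AllPairs.[]
allSubsets-unique (suc n) =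
  Unique.++⁺ (Unique.map⁺ ∷-injectiveʳ (allSubsets-unique n))
             (Unique.map⁺ ∷-injectiveʳ (allSubsets-unique n))
             disjoint
  where
  disjoint : ¬ (S L.∈ map (outside ∷_) (allSubsets n) × S L.∈ map (inside ∷_) (allSubsets n))
  disjoint (∈outside , ∈inside) with ∈-map⁻ (outside ∷_) ∈outside | ∈-map⁻ (inside ∷_) ∈inside
  ... | _ , _ , refl | _ , _ , ()

Independent : Graph n → Subset n → Set
Independent G S = ∀ {u v} → u ∈ S → v ∈ S → adj G u v ≡ false

independent⇒¬adj : ∀ (G : Graph n) → Independent G S →
                   ∀ {u v} → u ∈ S → v ∈ S → adj G u v ≢ true
independent⇒¬adj _ indep u∈S v∈S uv = contradiction (trans (sym uv) (indep u∈S v∈S)) λ ()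

member≡lookup : ∀ (S : Subset n) v → member S v ≡ lookup S v
member≡lookup S v with lookup S v
... | inside  = refl
... | outside = refl

member-true⇒∈ : member S x ≡ true → x ∈ S
member-true⇒∈ {S = S} {x} eq = lookup⇒[]= x S (trans (sym (member≡lookup S x)) eq)

∈⇒member-true : x ∈ S → member S x ≡ true
∈⇒member-true {x = x} {S} x∈S = trans (member≡lookup S x) ([]=⇒lookup x∈S)

∧-true⁻ : ∀ {a b} → a ∧ b ≡ true → a ≡ true × b ≡ true
∧-true⁻ {true} b≡true = refl , b≡true

allB-true⇒ : ∀ {A : Set} {q : A → Bool} {xs x} → allB q xs ≡ true → x L.∈ xs → q x ≡ true
allB-true⇒ all≡true (here refl)  = proj₁ (∧-true⁻ all≡true)
allB-true⇒ all≡true (there x∈xs) = allB-true⇒ (proj₂ (∧-true⁻ all≡true)) x∈xs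

⇒allB-true : ∀ {A : Set} {q : A → Bool} xs → (∀ x → q x ≡ true) → allB q xs ≡ true
⇒allB-true []       _      = refl
⇒allB-true (x ∷ xs) q-true rewrite q-true x = ⇒allB-true xs q-true

isIndependent⇒ : ∀ (G : Graph n) → isIndependent G S ≡ true → Independent G S
isIndependent⇒ {S = S} G indep {u} {v} u∈S v∈S = Bool.not-injective (trans
  (sym (cong₂ (λ a b → not (a ∧ b ∧ adj G u v)) (∈⇒member-true u∈S) (∈⇒member-true v∈S)))
  edge-free)
  where
  edge-free : not (member S u ∧ member S v ∧ adj G u v) ≡ true
  edge-free = allB-true⇒ (allB-true⇒ indep (∈-allFin u)) (∈-allFin v)

⇒isIndependent : ∀ (G : Graph n) → Independent G S → isIndependent G S ≡ true
⇒isIndependent {n} {S} G indep = ⇒allB-true (allFin n) λ u → ⇒allB-true (allFin n) λ v →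
  edge-free (member S u) (member S v) (adj G u v)
    λ u∈S v∈S → indep (member-true⇒∈ u∈S) (member-true⇒∈ v∈S)
  where
  edge-free : ∀ a b c → (a ≡ true → b ≡ true → c ≡ false) → not (a ∧ b ∧ c) ≡ true
  edge-free false _     _ _       = refl
  edge-free true  false _ _       = refl
  edge-free true  true  _ c≡false rewrite c≡false refl refl = refl

IndepSet : Graph n → ℕ → Subset n → Set
IndepSet G t S = Independent G S × ∣ S ∣ ≡ t

indepSets : Graph n → ℕ → List (Subset n)
indepSets {n} G t =
  filter (λ S → isIndependent G S Bool.≟ true) (filter (λ S → ∣ S ∣ ℕ.≟ t) (allSubsets n))

∈-indepSets⁺ : ∀ (G : Graph n) {t} → IndepSet G t S → S L.∈ indepSets G t
∈-indepSets⁺ {S = S} G {t} (indep , ∣S∣≡t) =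
  ∈-filter⁺ (λ S → isIndependent G S Bool.≟ true)
    (∈-filter⁺ (λ S → ∣ S ∣ ℕ.≟ t) (∈-allSubsets S) ∣S∣≡t) (⇒isIndependent G indep)

∈-indepSets⁻ : ∀ (G : Graph n) {t} → S L.∈ indepSets G t → IndepSet G t S
∈-indepSets⁻ {n} G {t} S∈ =
  let S∈sized , indep = ∈-filter⁻ (λ S → isIndependent G S Bool.≟ true)
                                  {xs = filter (λ S → ∣ S ∣ ℕ.≟ t) (allSubsets n)} S∈
  in  isIndependent⇒ G indep
    , proj₂ (∈-filter⁻ (λ S → ∣ S ∣ ℕ.≟ t) {xs = allSubsets n} S∈sized)

indepCount-< : ∀ {G H : Graph n} {t} (f : Subset n → Subset n) →
  (∀ {S} → IndepSet G t S → IndepSet H t (f S)) →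
  (∀ {S S′} → IndepSet G t S → IndepSet G t S′ → f S ≡ f S′ → S ≡ S′) →
  ∀ {K} → IndepSet H t K → (∀ {S} → IndepSet G t S → f S ≢ K) →
  indepCount G t < indepCount H t
indepCount-< {n} {G} {H} {t} f maps injective K-indep K-missed =
  length<-by-injectionOn f (Unique.filter⁺ _ (Unique.filter⁺ _ (allSubsets-unique n)))
    (∈-indepSets⁺ H ∘ maps ∘ ∈-indepSets⁻ G)
    (λ S∈ S′∈ → injective (∈-indepSets⁻ G S∈) (∈-indepSets⁻ G S′∈))
    (∈-indepSets⁺ H K-indep)
    (K-missed ∘ ∈-indepSets⁻ G)

∃-∈ : ∀ {A : Set} {xs : List A} → 1 ≤ length xs → ∃ (L._∈ xs)
∃-∈ {xs = x ∷ _} _ = x , here refl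

has-neighbour : (G : Graph n) → MinDegreeAtLeast1 G → ∀ v → ∃ λ u → adj G v u ≡ true
has-neighbour {n} G δ v =
  let u , u∈ = ∃-∈ (δ v)
  in  u , proj₂ (∈-filter⁻ (λ u → adj G v u Bool.≟ true) {xs = allFin n} u∈)

-- A selection rule that separates twins

does-<?-asym : x ≢ y → does (x <? y) ≢ does (y <? x)
does-<?-asym {x = x} {y} x≢y with <-cmp x y
... | tri< x<y _ _ = λ eq → contradiction
  (trans (sym (dec-true (x <? y) x<y)) (trans eq (dec-false (y <? x) (<-asym x<y)))) λ ()
... | tri≈ _ x≡y _ = contradiction x≡y x≢y
... | tri> _ _ y<x = λ eq → contradiction
  (trans (sym (dec-false (x <? y) (<-asym y<x))) (trans eq (dec-true (y <? x) y<x))) λ ()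

-- Vertices a ≠ b with p a ≡ b and p b ≡ a are twins.  Ranking by
-- key u = min (u, p u), ties broken by u, keeps twins together: they share a
-- key, so any vertex of another key lies below both or above both.
module Selection {m : ℕ} (p : Fin (suc m) → Fin (suc m)) where

  private variable
    a b c u v w : Fin (suc m)
    C : Subset (suc m)

  key : Fin (suc m) → ℕ
  key u = toℕ u ⊓ toℕ (p u)

  rank : Fin (suc m) → ℕ
  rank u = key u * suc m + toℕ u

  key<⇒rank< : key u < key v → rank u < rank v
  key<⇒rank< {u} {v} ku<kv = begin-strict
    key u * suc m + toℕ u   <⟨ +-monoʳ-< (key u * suc m) (toℕ<n u) ⟩
    key u * suc m + suc m   ≡⟨ +-comm (key u * suc m) (suc m) ⟩
    suc (key u) * suc m     ≤⟨ *-monoˡ-≤ (suc m) ku<kv ⟩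
    key v * suc m           ≤⟨ m≤m+n (key v * suc m) (toℕ v) ⟩
    key v * suc m + toℕ v   ∎
    where open ℕ.≤-Reasoning

  rank≤⇒key≤ : rank u ≤ rank v → key u ≤ key v
  rank≤⇒key≤ ru≤rv = ≮⇒≥ λ kv<ku → <⇒≱ (key<⇒rank< kv<ku) ru≤rv

  rank-injective : rank u ≡ rank v → u ≡ v
  rank-injective {u} {v} ru≡rv with ℕ.<-cmp (key u) (key v)
  ... | tri< ku<kv _ _ = contradiction ru≡rv (ℕ.<⇒≢ (key<⇒rank< ku<kv))
  ... | tri> _ _ kv<ku = contradiction (sym ru≡rv) (ℕ.<⇒≢ (key<⇒rank< kv<ku))
  ... | tri≈ _ ku≡kv _ = toℕ-injective (+-cancelˡ-≡ (key u * suc m) _ _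
                           (trans ru≡rv (cong (λ k → k * suc m + toℕ v) (sym ku≡kv))))

  rank-≤-via-key : key u ≢ key v → key v ≡ key w → rank u ≤ rank v → rank u ≤ rank w
  rank-≤-via-key {u} ku≢kv kv≡kw ru≤rv =
    <⇒≤ (key<⇒rank< (subst (key u <_) kv≡kw (≤∧≢⇒< (rank≤⇒key≤ ru≤rv) ku≢kv)))

  rank-≥-via-key : key u ≢ key v → key v ≡ key w → rank v ≤ rank u → rank w ≤ rank u
  rank-≥-via-key {u} ku≢kv kv≡kw rv≤ru =
    <⇒≤ (key<⇒rank< (subst (_< key u) kv≡kw (≤∧≢⇒< (rank≤⇒key≤ rv≤ru) (ku≢kv ∘ sym))))

  members : Subset (suc m) → List (Fin (suc m))
  members S = filter (_∈? S) (allFin (suc m))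

  ∈-members : u ∈ S → u L.∈ members S
  ∈-members {S = S} u∈S = ∈-filter⁺ (_∈? S) (∈-allFin _) u∈S

  members-∈ : u L.∈ members S → u ∈ S
  members-∈ {S = S} = proj₂ ∘ ∈-filter⁻ (_∈? S) {xs = allFin (suc m)}

  lowest : List (Fin (suc m)) → Fin (suc m)
  lowest []       = zero
  lowest (x ∷ xs) = argmin rank x xs

  lowest-∈ : ∀ {xs} → u L.∈ xs → lowest xs L.∈ xs
  lowest-∈ {xs = x ∷ xs} _ with argmin-sel rank x xs
  ... | inj₁ ≡x  = here ≡x
  ... | inj₂ ∈xs = there ∈xs

  lowest-≤ : ∀ {xs} → u L.∈ xs → rank (lowest xs) ≤ rank u
  lowest-≤ {xs = x ∷ xs} (here refl)  = f[argmin]≤f[⊤] {f = rank} x xs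
  lowest-≤ {xs = x ∷ xs} (there u∈xs) = All.lookup (f[argmin]≤f[xs] {f = rank} x xs) u∈xs

  first : Subset (suc m) → Fin (suc m)
  first S = lowest (members S)

  first-∈ : u ∈ S → first S ∈ S
  first-∈ = members-∈ ∘ lowest-∈ ∘ ∈-members

  first-≤ : u ∈ S → rank (first S) ≤ rank u
  first-≤ = lowest-≤ ∘ ∈-members

  first-unique : u ∈ S → (∀ {v} → v ∈ S → rank u ≤ rank v) → first S ≡ u
  first-unique u∈S u-lowest = rank-injective (ℕ.≤-antisym (first-≤ u∈S) (u-lowest (first-∈ u∈S)))

  second : Subset (suc m) → Fin (suc m)
  second S = first (S [ first S ]≔ outside)

  side : Fin (suc m) → Bool
  side u = does (u <? p u)

  choose : Subset (suc m) → Fin (suc m)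
  choose S with side (first S) Bool.≟ side (second S)
  ... | yes _ = first S
  ... | no _  = second S

  choose-cases : (choose S ≡ first S × side (first S) ≡ side (second S))
               ⊎ (choose S ≡ second S × side (first S) ≢ side (second S))
  choose-cases {S = S} with side (first S) Bool.≟ side (second S)
  ... | yes same = inj₁ (refl , same)
  ... | no diff  = inj₂ (refl , diff)

  choose-∈ : u ∈ S → v ∈ S → u ≢ v → choose S ∈ S
  choose-∈ {u} {S} {v} u∈S v∈S u≢v with choose-cases {S = S}
  ... | inj₁ (choose≡first , _)  = subst (_∈ S) (sym choose≡first) (first-∈ u∈S)
  ... | inj₂ (choose≡second , _) = subst (_∈ S) (sym choose≡second)
          (∈-update⁻ second∈S′ λ second≡first →
            ∉-delete (subst (_∈ S [ first S ]≔ outside) second≡first second∈S′))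
    where
    other : ∃ λ w → w ∈ S × w ≢ first S
    other with u ≟ first S
    ... | yes refl = v , v∈S , u≢v ∘ sym
    ... | no u≢f   = u , u∈S , u≢f
    second∈S′ : second S ∈ S [ first S ]≔ outside
    second∈S′ = let w , w∈S , w≢f = other in first-∈ (∈-update⁺ w∈S w≢f outside)

  side-twins : a ≢ b → p a ≡ b → p b ≡ a → side a ≢ side b
  side-twins {a} {b} a≢b pa≡b pb≡a =
    subst₂ (λ x y → does (a <? x) ≢ does (b <? y)) (sym pa≡b) (sym pb≡a) (does-<?-asym a≢b)

  key-twins : p a ≡ b → p b ≡ a → key a ≡ key b
  key-twins {a} {b} refl pb≡a =
    trans (ℕ.⊓-comm (toℕ a) (toℕ b)) (cong (λ x → toℕ b ⊓ toℕ x) (sym pb≡a))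

  key-≢ : p a ≡ b → c ≢ a → c ≢ b → p c ≢ a → p c ≢ b → key c ≢ key a
  key-≢ {a} {b} {c} refl c≢a c≢b pc≢a pc≢b kc≡ka
    with ⊓-sel (toℕ c) (toℕ (p c)) | ⊓-sel (toℕ a) (toℕ (p a))
  ... | inj₁ kc≡c  | inj₁ ka≡a  = c≢a  (toℕ-injective (trans (sym kc≡c)  (trans kc≡ka ka≡a)))
  ... | inj₁ kc≡c  | inj₂ ka≡pa = c≢b  (toℕ-injective (trans (sym kc≡c)  (trans kc≡ka ka≡pa)))
  ... | inj₂ kc≡pc | inj₁ ka≡a  = pc≢a (toℕ-injective (trans (sym kc≡pc) (trans kc≡ka ka≡a)))
  ... | inj₂ kc≡pc | inj₂ ka≡pa = pc≢b (toℕ-injective (trans (sym kc≡pc) (trans kc≡ka ka≡pa)))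

  second-after-first : x ∉ C → first (C [ x ]≔ inside) ≡ x → second (C [ x ]≔ inside) ≡ first C
  second-after-first {x} {C} x∉C first≡x =
    trans (cong (λ y → first ((C [ x ]≔ inside) [ y ]≔ outside)) first≡x)
          (cong first (delete-insert x∉C))

  side-if-chosen-first : c ∈ C → x ∉ C →
    first (C [ x ]≔ inside) ≡ x → choose (C [ x ]≔ inside) ≡ x → side x ≡ side (first C)
  side-if-chosen-first {c} {C} {x} c∈C x∉C first≡x choose≡x with choose-cases {S = C [ x ]≔ inside}
  ... | inj₁ (_ , same) =
    trans (cong side (sym first≡x)) (trans same (cong side (second-after-first x∉C first≡x)))
  ... | inj₂ (choose≡second , _) = contradiction (subst (_∈ C) firstC≡x (first-∈ c∈C)) x∉C
    where
    firstC≡x : first C ≡ x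
    firstC≡x = trans (sym (second-after-first x∉C first≡x)) (trans (sym choose≡second) choose≡x)

  side-if-chosen-second : choose S ≡ x → first S ≢ x → side x ≢ side (first S)
  side-if-chosen-second {S = S} {x} choose≡x first≢x with choose-cases {S = S}
  ... | inj₁ (choose≡first , _)     = contradiction (trans (sym choose≡first) choose≡x) first≢x
  ... | inj₂ (choose≡second , diff) =
          subst (λ y → side y ≢ side (first S)) (trans (sym choose≡second) choose≡x) (diff ∘ sym)

  module Twins {a b C} (a≢b : a ≢ b) (pa≡b : p a ≡ b) (pb≡a : p b ≡ a)
               (a∉C : a ∉ C) (b∉C : b ∉ C) (p[C]∌ab : ∀ {u} → u ∈ C → p u ≢ a × p u ≢ b) where

    ka≡kb : key a ≡ key b
    ka≡kb = key-twins pa≡b pb≡a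

    key[C]≢ka : u ∈ C → key u ≢ key a
    key[C]≢ka u∈C = key-≢ pa≡b (λ { refl → a∉C u∈C }) (λ { refl → b∉C u∈C })
                      (proj₁ (p[C]∌ab u∈C)) (proj₂ (p[C]∌ab u∈C))

    first-if-twin-first : first (C [ a ]≔ inside) ≡ a → first (C [ b ]≔ inside) ≡ b
    first-if-twin-first firstA≡a =
      first-unique (∈-insert {S = C}) λ {v} v∈B → case ∈-insert⁻ v∈B of λ where
      (inj₁ refl) → ≤-refl
      (inj₂ v∈C)  → rank-≥-via-key (key[C]≢ka v∈C) ka≡kb
                      (subst (λ y → rank y ≤ rank v) firstA≡a (first-≤ (∈-insert⁺ v∈C)))

    first-if-twin-not-first : first (C [ a ]≔ inside) ≢ a →
      first (C [ a ]≔ inside) ∈ C × first (C [ b ]≔ inside) ≡ first (C [ a ]≔ inside)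
    first-if-twin-not-first firstA≢a =
      r∈C , first-unique (∈-insert⁺ r∈C) λ v∈B → case ∈-insert⁻ v∈B of λ where
        (inj₁ refl) → rank-≤-via-key (key[C]≢ka r∈C) ka≡kb (first-≤ (∈-insert {S = C}))
        (inj₂ v∈C)  → first-≤ (∈-insert⁺ v∈C)
      where
      r∈C : first (C [ a ]≔ inside) ∈ C
      r∈C = case ∈-insert⁻ (first-∈ (∈-insert {S = C})) of λ where
        (inj₁ r≡a) → contradiction r≡a firstA≢a
        (inj₂ r∈C) → r∈C

    -- In C + a and C + b the rule weighs the twin against the same vertex of C
    -- (first C if the twin comes first, else the common first element); twins
    -- have opposite sides, so at most one of them is chosen.
    ¬choose-both : c ∈ C → ¬ (choose (C [ a ]≔ inside) ≡ a × choose (C [ b ]≔ inside) ≡ b)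
    ¬choose-both c∈C (chooseA≡a , chooseB≡b) with first (C [ a ]≔ inside) ≟ a
    ... | yes firstA≡a = side-twins a≢b pa≡b pb≡a (trans
          (side-if-chosen-first c∈C a∉C firstA≡a chooseA≡a)
          (sym (side-if-chosen-first c∈C b∉C (first-if-twin-first firstA≡a) chooseB≡b)))
    ... | no firstA≢a =
          let r∈C , firstB≡r = first-if-twin-not-first firstA≢a
              firstB≢b = λ firstB≡b → b∉C (subst (_∈ C) (trans (sym firstB≡r) firstB≡b) r∈C)
          in  side-twins a≢b pa≡b pb≡a (trans
                (Bool.¬-not (side-if-chosen-second chooseA≡a firstA≢a))
                (sym (Bool.¬-not (subst (λ y → side b ≢ side y) firstB≡r
                                        (side-if-chosen-second chooseB≡b firstB≢b)))))

-- Stars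

module _ {m : ℕ} where

  star-independent : zero ∉ S → Independent (star m) S
  star-independent 0∉S {zero}          u∈S _   = contradiction u∈S 0∉S
  star-independent 0∉S {suc _} {zero}  _   v∈S = contradiction v∈S 0∉S
  star-independent 0∉S {suc _} {suc _} _   _   = refl

  StarAt : Graph (suc m) → Fin (suc m) → Set
  StarAt G c = ∀ {u v} → adj G u v ≡ true → u ≡ c ⊎ v ≡ c

  starAdj-xor : ∀ (x y : Fin (suc m)) → starAdj x y ≡ does (x ≟ zero) xor does (y ≟ zero)
  starAdj-xor zero    zero    = refl
  starAdj-xor zero    (suc _) = refl
  starAdj-xor (suc _) zero    = refl
  starAdj-xor (suc _) (suc _) = refl

  starAt-adjacent : ∀ (G : Graph (suc m)) {c} → MinDegreeAtLeast1 G → StarAt G c →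
    ∀ {w} → w ≢ c → adj G w c ≡ true
  starAt-adjacent G δ star {w} w≢c with has-neighbour G δ w
  ... | u , wu with star {w} {u} wu
  ...   | inj₁ w≡c = contradiction w≡c w≢c
  ...   | inj₂ refl = wu

  starAt-xor : ∀ (G : Graph (suc m)) {c} → MinDegreeAtLeast1 G → StarAt G c →
    ∀ u v → adj G u v ≡ does (u ≟ c) xor does (v ≟ c)
  starAt-xor G {c} δ star u v with u ≟ c | v ≟ c
  ... | yes refl | yes refl = loopless G c
  ... | yes refl | no v≢c   = trans (adj-sym G c v) (starAt-adjacent G δ star v≢c)
  ... | no u≢c   | yes refl = starAt-adjacent G δ star u≢c
  ... | no u≢c   | no v≢c   = Bool.¬-not λ uv → [ u≢c , v≢c ] (star uv)

  starAt⇒≅star : ∀ (G : Graph (suc m)) {c} → MinDegreeAtLeast1 G → StarAt G c → G ≅ star m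
  starAt⇒≅star G {c} δ star = τ , λ u v → begin
    adj G u v                                         ≡⟨ starAt-xor G δ star u v ⟩
    does (u ≟ c) xor does (v ≟ c)                     ≡⟨ cong₂ _xor_ (τ≡0⇔≡c u) (τ≡0⇔≡c v) ⟨
    does (τ ⟨$⟩ʳ u ≟ zero) xor does (τ ⟨$⟩ʳ v ≟ zero) ≡⟨ starAdj-xor (τ ⟨$⟩ʳ u) (τ ⟨$⟩ʳ v) ⟨
    starAdj (τ ⟨$⟩ʳ u) (τ ⟨$⟩ʳ v)                     ∎
    where
    open ≡-Reasoning
    τ = transpose c zero
    τ≡0⇔≡c : ∀ u → does (τ ⟨$⟩ʳ u ≟ zero) ≡ does (u ≟ c)
    τ≡0⇔≡c u = does-⇔ (mk⇔ τu≡0⇒u≡c λ { refl → inverseʳ τ {zero} })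
                      (τ ⟨$⟩ʳ u ≟ zero) (u ≟ c)
      where
      τu≡0⇒u≡c : τ ⟨$⟩ʳ u ≡ zero → u ≡ c
      τu≡0⇒u≡c τu≡0 = trans (sym (inverseˡ τ {u})) (cong (τ ⟨$⟩ˡ_) τu≡0)

  StarObstruction : Graph (suc m) → Set
  StarObstruction G = ∃ λ a → ∃ λ b → ∃ λ z →
    a ≢ zero × b ≢ zero × adj G a b ≡ true × adj G zero z ≡ true × z ≢ a × z ≢ b

  starObstruction? : (G : Graph (suc m)) → Dec (StarObstruction G)
  starObstruction? G = any? λ a → any? λ b → any? λ z →
    ¬? (a ≟ zero) ×-dec ¬? (b ≟ zero) ×-dec adj G a b Bool.≟ true ×-dec adj G zero z Bool.≟ true ×-dec
    ¬? (z ≟ a) ×-dec ¬? (z ≟ b)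

  module Unobstructed (G : Graph (suc m)) (δ : MinDegreeAtLeast1 G) (3≤m : 3 ≤ m)
                      (unobstructed : ¬ StarObstruction G) where

    private
      p : Fin (suc m) → Fin (suc m)
      p = proj₁ ∘ has-neighbour G δ

      p-adj : ∀ v → adj G v (p v) ≡ true
      p-adj = proj₂ ∘ has-neighbour G δ

    neighbour-of-0-on-edge : ∀ {x y z} → x ≢ zero → y ≢ zero → adj G x y ≡ true →
      adj G zero z ≡ true → z ≡ x ⊎ z ≡ y
    neighbour-of-0-on-edge {x} {y} {z} x≢0 y≢0 xy 0z with z ≟ x | z ≟ y
    ... | yes z≡x | _       = inj₁ z≡x
    ... | no _    | yes z≡y = inj₂ z≡y
    ... | no z≢x  | no z≢y  = contradiction (x , y , z , x≢0 , y≢0 , xy , 0z , z≢x , z≢y) unobstructed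

    off-edge-not-neighbour : ∀ {a b c} → a ≢ zero → b ≢ zero → adj G a b ≡ true →
      c ≢ a → c ≢ b → adj G zero c ≢ true
    off-edge-not-neighbour a≢0 b≢0 ab c≢a c≢b 0c =
      [ c≢a , c≢b ] (neighbour-of-0-on-edge a≢0 b≢0 ab 0c)

    neighbour-of-0≡p : ∀ {a b c} → a ≢ zero → b ≢ zero → adj G a b ≡ true →
      c ≢ zero → c ≢ a → c ≢ b → ∀ {z} → adj G zero z ≡ true → z ≡ p c
    neighbour-of-0≡p {a} {b} {c} a≢0 b≢0 ab c≢0 c≢a c≢b 0z =
      case neighbour-of-0-on-edge c≢0 pc≢0 (p-adj c) 0z of λ where
        (inj₁ refl) → contradiction 0z (off-edge-not-neighbour a≢0 b≢0 ab c≢a c≢b)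
        (inj₂ z≡pc) → z≡pc
      where
      pc≢0 : p c ≢ zero
      pc≢0 pc≡0 = off-edge-not-neighbour a≢0 b≢0 ab c≢a c≢b
                    (trans (adj-sym G zero c) (subst (λ y → adj G c y ≡ true) pc≡0 (p-adj c)))

    neighbour-of-0-unique : ∀ {a b} → a ≢ zero → b ≢ zero → adj G a b ≡ true →
      ∀ {z} → adj G zero z ≡ true → z ≡ p zero
    neighbour-of-0-unique {a} {b} a≢0 b≢0 ab 0z =
      let c , c≢0 , c≢a , c≢b = ∃-∉triple zero a b (s≤s 3≤m)
          ≡pc = neighbour-of-0≡p a≢0 b≢0 ab c≢0 c≢a c≢b
      in  trans (≡pc 0z) (sym (≡pc (p-adj zero)))

    edge-off-0⇒starAt : ∀ {a b} → a ≢ zero → b ≢ zero → adj G a b ≡ true → StarAt G (p zero)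
    edge-off-0⇒starAt a≢0 b≢0 ab {u} {v} uv with u ≟ zero | v ≟ zero
    ... | yes refl | _        = inj₂ (neighbour-of-0-unique a≢0 b≢0 ab uv)
    ... | no _     | yes refl = inj₁ (neighbour-of-0-unique a≢0 b≢0 ab (trans (adj-sym G zero u) uv))
    ... | no u≢0   | no v≢0   = Sum.map sym sym (neighbour-of-0-on-edge u≢0 v≢0 uv (p-adj zero))

    no-edge-off-0⇒starAt : (∀ {a b} → a ≢ zero → b ≢ zero → adj G a b ≢ true) → StarAt G zero
    no-edge-off-0⇒starAt no-edge {u} {v} uv with u ≟ zero | v ≟ zero
    ... | yes u≡0 | _       = inj₁ u≡0
    ... | no _    | yes v≡0 = inj₂ v≡0
    ... | no u≢0  | no v≢0  = contradiction uv (no-edge u≢0 v≢0)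

    starAt : ∃ (StarAt G)
    starAt with any? (λ a → any? λ b → ¬? (a ≟ zero) ×-dec ¬? (b ≟ zero) ×-dec adj G a b Bool.≟ true)
    ... | yes (_ , _ , a≢0 , b≢0 , ab) = p zero , edge-off-0⇒starAt a≢0 b≢0 ab
    ... | no no-edge = zero , no-edge-off-0⇒starAt λ a≢0 b≢0 ab → no-edge (_ , _ , a≢0 , b≢0 , ab)

  ≇star⇒obstruction : ∀ (G : Graph (suc m)) → MinDegreeAtLeast1 G → 3 ≤ m → ¬ G ≅ star m →
                      StarObstruction G
  ≇star⇒obstruction G δ 3≤m G≇star with starObstruction? G
  ... | yes obstruction = obstruction
  ... | no unobstructed =
    contradiction (starAt⇒≅star G δ (proj₂ (Unobstructed.starAt G δ 3≤m unobstructed))) G≇star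

-- The injection

module Injection {m t} (G : Graph (suc m)) (δ : MinDegreeAtLeast1 G) (3≤t : 3 ≤ t) where

  p : Fin (suc m) → Fin (suc m)
  p = proj₁ ∘ has-neighbour G δ

  p-adj : ∀ v → adj G v (p v) ≡ true
  p-adj = proj₂ ∘ has-neighbour G δ

  open Selection p

  φ : Subset (suc m) → Subset (suc m)
  φ (outside ∷ S) = outside ∷ S
  φ (inside ∷ S)  = (outside ∷ S) [ p (choose (outside ∷ S)) ]≔ inside

  independent⇒p∉ : Independent G S → ∀ {v} → v ∈ S → p v ∉ S
  independent⇒p∉ indep v∈S pv∈S = independent⇒¬adj G indep v∈S pv∈S (p-adj _)

  IndepSet₀ : Subset m → Set
  IndepSet₀ S = IndepSet G t (inside ∷ S)

  module Rooted {S : Subset m} (I : IndepSet₀ S) where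

    J : Subset (suc m)
    J = outside ∷ S

    J⊆I : J ⊆ inside ∷ S
    J⊆I (there u∈S) = there u∈S

    J-indep : Independent G J
    J-indep u∈J v∈J = proj₁ I (J⊆I u∈J) (J⊆I v∈J)

    J-has-two : ∃₂ λ x y → x ∈ J × y ∈ J × x ≢ y
    J-has-two = two-members (≤-pred (subst (3 ≤_) (sym (proj₂ I)) 3≤t))

    v : Fin (suc m)
    v = choose J

    w : Fin (suc m)
    w = p v

    v∈J : v ∈ J
    v∈J = let x , x′ , x∈J , x′∈J , x≢x′ = J-has-two in choose-∈ x∈J x′∈J x≢x′

    w∉J : w ∉ J
    w∉J = independent⇒p∉ J-indep v∈J

    w≢0 : w ≢ zero
    w≢0 w≡0 = independent⇒¬adj G (proj₁ I) (J⊆I v∈J) here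
                (subst (λ x → adj G v x ≡ true) w≡0 (p-adj v))

    K : Subset (suc m)
    K = J [ w ]≔ inside

    K-size : ∣ K ∣ ≡ t
    K-size = trans (∣insert∣≡ w∉J) (proj₂ I)

    0∉K : zero ∉ K
    0∉K 0∈K with ∈-insert⁻ 0∈K
    ... | inj₁ 0≡w = w≢0 (sym 0≡w)
    ... | inj₂ ()

    K-dependent : ¬ Independent G K
    K-dependent indep = independent⇒¬adj G indep (∈-insert⁺ v∈J) ∈-insert (p-adj v)

  added-vertices-cross : ∀ {S₁ S₂} (I₁ : IndepSet₀ S₁) (I₂ : IndepSet₀ S₂) →
    Rooted.K I₁ ≡ Rooted.K I₂ → Rooted.w I₁ ≢ Rooted.w I₂ → Rooted.v I₁ ≡ Rooted.w I₂
  added-vertices-cross I₁ I₂ K₁≡K₂ w₁≢w₂ = case R₁.v ≟ R₂.w of λ where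
      (yes v₁≡w₂) → v₁≡w₂
      (no v₁≢w₂)  → contradiction (p-adj R₁.v)
          (independent⇒¬adj G R₂.J-indep (in-J₂ (∈-insert⁺ R₁.v∈J) v₁≢w₂) (in-J₂ ∈-insert w₁≢w₂))
    where
    module R₁ = Rooted I₁
    module R₂ = Rooted I₂
    in-J₂ : ∀ {u} → u ∈ R₁.K → u ≢ R₂.w → u ∈ R₂.J
    in-J₂ u∈K₁ u≢w₂ = ∈-update⁻ (subst (_ ∈_) K₁≡K₂ u∈K₁) u≢w₂

  -- Distinct added vertices w₁ ≠ w₂ would be twins, with J₁ = C + w₂ and J₂ = C + w₁.
  ¬distinct-added-vertices : ∀ {S₁ S₂} (I₁ : IndepSet₀ S₁) (I₂ : IndepSet₀ S₂) →
    Rooted.K I₁ ≡ Rooted.K I₂ → ¬ Rooted.w I₁ ≢ Rooted.w I₂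
  ¬distinct-added-vertices I₁ I₂ K₁≡K₂ w₁≢w₂ =
    Twins.¬choose-both (w₁≢w₂ ∘ sym) (cong p (sym v₁≡w₂)) (cong p (sym v₂≡w₁))
      ∉-delete w₁∉C p[C]∌w (proj₂ c∈C)
      (trans (cong choose J₁≡) v₁≡w₂ , trans (cong choose J₂≡) v₂≡w₁)
    where
    module R₁ = Rooted I₁
    module R₂ = Rooted I₂
    v₁≡w₂ : R₁.v ≡ R₂.w
    v₁≡w₂ = added-vertices-cross I₁ I₂ K₁≡K₂ w₁≢w₂
    v₂≡w₁ : R₂.v ≡ R₁.w
    v₂≡w₁ = added-vertices-cross I₂ I₁ (sym K₁≡K₂) (w₁≢w₂ ∘ sym)
    C : Subset (suc m)
    C = R₁.J [ R₂.w ]≔ outside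
    J₁≡ : C [ R₂.w ]≔ inside ≡ R₁.J
    J₁≡ = insert-delete (subst (_∈ R₁.J) v₁≡w₂ R₁.v∈J)
    J₂≡ : C [ R₁.w ]≔ inside ≡ R₂.J
    J₂≡ = begin
      C [ R₁.w ]≔ inside      ≡⟨ []≔-commutes R₁.J R₁.w R₂.w w₁≢w₂ ⟨
      R₁.K [ R₂.w ]≔ outside  ≡⟨ cong (_[ R₂.w ]≔ outside) K₁≡K₂ ⟩
      R₂.K [ R₂.w ]≔ outside  ≡⟨ delete-insert R₂.w∉J ⟩
      R₂.J                    ∎
      where open ≡-Reasoning
    w₁∉C : R₁.w ∉ C
    w₁∉C w₁∈C = R₁.w∉J (∈-update⁻ w₁∈C w₁≢w₂)
    c∈C : ∃ (_∈ C)
    c∈C with R₁.J-has-two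
    ... | x , x′ , x∈J₁ , x′∈J₁ , x≢x′ with x ≟ R₂.w
    ...   | yes refl = x′ , ∈-update⁺ x′∈J₁ (x≢x′ ∘ sym) outside
    ...   | no x≢w₂  = x , ∈-update⁺ x∈J₁ x≢w₂ outside
    p-avoids : Independent G S → ∀ {u x} → u ∈ S → x ∈ S → p u ≢ x
    p-avoids indep u∈S x∈S refl = independent⇒p∉ indep u∈S x∈S
    p[C]∌w : ∀ {u} → u ∈ C → p u ≢ R₂.w × p u ≢ R₁.w
    p[C]∌w {u} u∈C =
        p-avoids R₁.J-indep (∈-update⁻ u∈C u≢w₂) (subst (_∈ R₁.J) v₁≡w₂ R₁.v∈J)
      , p-avoids R₂.J-indep (subst (u ∈_) J₂≡ (∈-insert⁺ u∈C)) (subst (_∈ R₂.J) v₂≡w₁ R₂.v∈J)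
      where
      u≢w₂ : u ≢ R₂.w
      u≢w₂ refl = ∉-delete u∈C

  added-vertex-determined : ∀ {S₁ S₂} (I₁ : IndepSet₀ S₁) (I₂ : IndepSet₀ S₂) →
    Rooted.K I₁ ≡ Rooted.K I₂ → Rooted.w I₁ ≡ Rooted.w I₂
  added-vertex-determined I₁ I₂ K₁≡K₂ =
    decidable-stable (Rooted.w I₁ ≟ Rooted.w I₂) (¬distinct-added-vertices I₁ I₂ K₁≡K₂)

  φ-maps : IndepSet G t S → IndepSet (star m) t (φ S)
  φ-maps {S = outside ∷ _} (_ , size) = star-independent (λ ()) , size
  φ-maps {S = inside ∷ _}  I          = star-independent (Rooted.0∉K I) , Rooted.K-size I

  φ-injective : IndepSet G t S → IndepSet G t T → φ S ≡ φ T → S ≡ T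
  φ-injective {S = outside ∷ _} {outside ∷ _} _ _ φS≡φT = φS≡φT
  φ-injective {S = outside ∷ _} {inside ∷ _}  I I′ φS≡φT =
    ⊥-elim (Rooted.K-dependent I′ (subst (Independent G) φS≡φT (proj₁ I)))
  φ-injective {S = inside ∷ _}  {outside ∷ _} I I′ φS≡φT =
    ⊥-elim (Rooted.K-dependent I (subst (Independent G) (sym φS≡φT) (proj₁ I′)))
  φ-injective {S = inside ∷ _}  {inside ∷ _}  I I′ K≡K′  = cong (inside ∷_) (∷-injectiveʳ (begin
    R.J                     ≡⟨ delete-insert R.w∉J ⟨
    R.K [ R.w ]≔ outside    ≡⟨ cong₂ (λ K w → K [ w ]≔ outside) K≡K′ (added-vertex-determined I I′ K≡K′) ⟩
    R′.K [ R′.w ]≔ outside  ≡⟨ delete-insert R′.w∉J ⟩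
    R′.J                    ∎))
    where
    open ≡-Reasoning
    module R = Rooted I
    module R′ = Rooted I′

  leaves : Subset (suc m)
  leaves = outside ∷ ⊤

  ≢0⇒∈leaves : x ≢ zero → x ∈ leaves
  ≢0⇒∈leaves {x = zero}  x≢0 = contradiction refl x≢0
  ≢0⇒∈leaves {x = suc _} _   = there ∈⊤

  leaf-set-⊇triple : ∀ {a b z} → a ≢ zero → b ≢ zero → z ≢ zero → t ≤ m →
    ∃ λ K → triple a b z ⊆ K × zero ∉ K × ∣ K ∣ ≡ t
  leaf-set-⊇triple {a} {b} {z} a≢0 b≢0 z≢0 t≤m =
    let K , abz⊆K , K⊆leaves , ∣K∣≡t = ⊆-extend abz⊆leaves (≤-trans (∣triple∣≤3 a b z) 3≤t)
                                                 (subst (t ≤_) (sym (∣⊤∣≡n m)) t≤m)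
    in  K , abz⊆K , (λ 0∈K → case K⊆leaves 0∈K of λ ()) , ∣K∣≡t
    where
    abz⊆leaves : triple a b z ⊆ leaves
    abz⊆leaves u∈abz with ∈-triple⁻ a b z u∈abz
    ... | inj₁ refl        = ≢0⇒∈leaves a≢0
    ... | inj₂ (inj₁ refl) = ≢0⇒∈leaves b≢0
    ... | inj₂ (inj₂ refl) = ≢0⇒∈leaves z≢0

  -- A set I ∌ 0 containing a and b would contain the edge a b; from a set
  -- I ∋ 0 only one vertex is added, necessarily z, which leaves a b in J.
  ∉image : ∀ {a b z K} → adj G a b ≡ true → adj G zero z ≡ true → z ≢ a → z ≢ b →
    a ∈ K → b ∈ K → z ∈ K → IndepSet G t S → φ S ≢ K
  ∉image {S = outside ∷ _} ab _ _ _ a∈K b∈K _ I S≡K =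
    independent⇒¬adj G (proj₁ I) (subst (_ ∈_) (sym S≡K) a∈K) (subst (_ ∈_) (sym S≡K) b∈K) ab
  ∉image {S = inside ∷ _} {K = K} ab 0z z≢a z≢b a∈K b∈K z∈K I K′≡K
    with ∈-insert⁻ (subst (_ ∈_) (sym K′≡K) z∈K)
  ... | inj₂ z∈J = independent⇒¬adj G (proj₁ I) here (Rooted.J⊆I I z∈J) 0z
  ... | inj₁ z≡w = independent⇒¬adj G (Rooted.J-indep I)
                     (in-J a∈K (z≢a ∘ trans z≡w ∘ sym)) (in-J b∈K (z≢b ∘ trans z≡w ∘ sym)) ab
    where
    in-J : ∀ {u} → u ∈ K → u ≢ Rooted.w I → u ∈ Rooted.J I
    in-J u∈K u≢w = ∈-update⁻ (subst (_ ∈_) (sym K′≡K) u∈K) u≢w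

  missed-set : t ≤ m → StarObstruction G →
               ∃ λ K → IndepSet (star m) t K × (∀ {S} → IndepSet G t S → φ S ≢ K)
  missed-set t≤m (a , b , z , a≢0 , b≢0 , ab , 0z , z≢a , z≢b) =
    let K , abz⊆K , 0∉K , ∣K∣≡t = leaf-set-⊇triple a≢0 b≢0 z≢0 t≤m
        a∈ , b∈ , z∈ = ∈-triple a b z
    in  K , (star-independent 0∉K , ∣K∣≡t) , ∉image ab 0z z≢a z≢b (abz⊆K a∈) (abz⊆K b∈) (abz⊆K z∈)
    where
    z≢0 : z ≢ zero
    z≢0 refl = contradiction (trans (sym 0z) (loopless G zero)) λ ()

theorem1p10 : (m t : ℕ) → 4 ≤ suc m → 3 ≤ t → t ≤ suc m ∸ 1 →
    (G : Graph (suc m)) → MinDegreeAtLeast1 G → ¬ (G ≅ star m) →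
    indepCount G t < indepCount (star m) t
-- n ≥ 4 already follows from 3 ≤ t ≤ n - 1.
theorem1p10 m t _ 3≤t t≤m G δ G≇star =
  let K , K-indep , K-missed = missed-set t≤m (≇star⇒obstruction G δ (≤-trans 3≤t t≤m) G≇star)
  in  indepCount-< {G = G} {star m} φ φ-maps φ-injective K-indep K-missed
  where open Injection G δ 3≤t
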